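{- For $n\geq 1$, the number of permutations $\pi\in\mathcal{S}_n$ such that $\pi^3$ is the decreasing permutation $n(n-1)\cdots 21$ equals \[\sum_{i=0}^{\lfloor\frac{n}{6}\rfloor}\binom{\lfloor\frac{n}{2}\rfloor}{3i}\frac{(3i)!}{i!\,3^i}\cdot 4^i.\]
   Context: $\mathcal{S}_n$ is the symmetric group on $[n]$, permutations written in one-line notation; $\pi^3=\pi\circ\pi\circ\pi$. The decreasing permutation is $i\mapsto n+1-i$. -}

module Defs where

open import Data.Nat using (ℕ; zero; suc; _*_; _^_; _/_; _!; NonZero)
open import Data.Nat.Properties using (m*n≢0; m^n≢0; _!≢0)
open import Data.Nat.Combinatorics using (_C_)
open import Data.Fin using (Fin; opposite)
open import Data.Fin.Properties using (_≟_; all?)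
open import Data.Vec using (Vec; []; _∷_; lookup)
open import Data.List using (List; []; _∷_; map; concatMap; filter; length; allFin; upTo)
open import Data.Nat.ListAction using (sum)
open import Data.Product using (_×_)
open import Relation.Nullary using (Dec)
open import Relation.Nullary.Decidable using (_→-dec_; _×-dec_)
open import Relation.Binary.PropositionalEquality using (_≡_)

-- A map [n] → [n] in one-line notation: position i ↦ entry w(i).
-- (Fin n = {0,…,n-1} stands for [n] = {1,…,n} via i ↦ i+1.)
Word : ℕ → Set
Word n = Vec (Fin n) n

words : ∀ {A : Set} → List A → (k : ℕ) → List (Vec A k)
words xs zero    = [] ∷ []
words xs (suc k) = concatMap (λ x → map (x ∷_) (words xs k)) xs

allWords : (n : ℕ) → List (Word n)
allWords n = words (allFin n) n

IsPerm : ∀ {n} → Word n → Set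
IsPerm {n} w = (i j : Fin n) → lookup w i ≡ lookup w j → i ≡ j

-- π^3 = π ∘ π ∘ π equals the decreasing permutation i ↦ n+1-i
-- (on Fin n this is i ↦ n-1-i, i.e. Data.Fin.opposite).
CubeIsDecreasing : ∀ {n} → Word n → Set
CubeIsDecreasing {n} w =
  (i : Fin n) → lookup w (lookup w (lookup w i)) ≡ opposite i

isPerm? : ∀ {n} (w : Word n) → Dec (IsPerm w)
isPerm? w = all? λ i → all? λ j → (lookup w i ≟ lookup w j) →-dec (i ≟ j)

cubeIsDecreasing? : ∀ {n} (w : Word n) → Dec (CubeIsDecreasing w)
cubeIsDecreasing? w = all? λ i → lookup w (lookup w (lookup w i)) ≟ opposite i

countCubeRootsOfDecreasing : ℕ → ℕ
countCubeRootsOfDecreasing n =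
  length (filter (λ w → isPerm? w ×-dec cubeIsDecreasing? w) (allWords n))

-- Summand:  C(⌊n/2⌋, 3i) · (3i)! / (i! 3^i) · 4^i
-- (the division is exact; the denominator i!·3^i is nonzero)
denom : ℕ → ℕ
denom i = i ! * 3 ^ i

denom≢0 : ∀ i → NonZero (denom i)
denom≢0 i = m*n≢0 (i !) (3 ^ i) ⦃ i !≢0 ⦄ ⦃ m^n≢0 3 i ⦄

term : ℕ → ℕ → ℕ
term n i = ((n / 2) C (3 * i)) * ((((3 * i) !) / denom i) ⦃ denom≢0 i ⦄ * 4 ^ i)

formula : ℕ → ℕ
formula n = sum (map (term n) (upTo (suc (n / 6))))

-- Conjugating by the zigzag enumeration 0, n-1, 1, n-2, … turns the decreasing permutation into the
-- involution σ = (0 1)(2 3)⋯ (the last point fixed when n is odd), so we count cube roots π of σ.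
-- Such a π is injective and commutes with σ, so π 0 is neither 0 nor a fixed point of σ.
-- If π 0 = 1 then π swaps the first pair and is a cube root of σ on the remaining n - 2 points.
-- Otherwise an involution commuting with σ and fixing 0 moves π 0 to 2; then π 2 lies outside
-- the first two pairs and is not fixed by σ, a second such involution moves it to 4, and π is forced
-- to be the 6-cycle (0 2 4 1 3 5) on the first three pairs and a cube root on the other n - 6 points.
-- Writing c n for the count, this gives c (n + 2) = c n + 4 ⌊n/2⌋ ⌊(n-2)/2⌋ c (n - 4), and by
-- Pascal's rule the closed formula, as a function of the number ⌊n/2⌋ of pairs, obeys the same
-- recurrence with the same initial values.
module Submission where

open import Defs
open import Data.Bool using (Bool; true; false; if_then_else_; _∧_)
open import Data.Empty using (⊥-elim)
open import Data.Fin using (Fin; zero; suc; toℕ; fromℕ; inject₁; opposite; _↑ˡ_; _↑ʳ_; splitAt; join)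
open import Data.Fin.Patterns using (0F; 1F; 2F; 3F; 4F; 5F)
open import Data.Fin.Properties
  using (_≟_; all?; suc-injective; opposite-involutive; ↑ʳ-injective; splitAt-↑ˡ; splitAt-↑ʳ;
         splitAt⁻¹-↑ˡ; splitAt⁻¹-↑ʳ; join-splitAt)
open import Data.Fin.Relation.Unary.Top using (View; view; ‵fromℕ; ‵inject₁; view-fromℕ; view-inject₁)
open import Data.List
  using (List; []; _∷_; _++_; map; applyUpTo; filter; length; concatMap; cartesianProductWith; allFin)
open import Data.List.Membership.Propositional using (_∈_)
open import Data.List.Membership.Propositional.Properties
  using (∈-map⁺; ∈-map⁻; ∈-filter⁺; ∈-filter⁻; ∈-cartesianProductWith⁺; ∈-allFin)
open import Data.List.Membership.Propositional.Properties.WithK using (unique∧set⇒bag)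
open import Data.List.Properties using (length-map; filter-none)
open import Data.List.Relation.Binary.BagAndSetEquality using (∼bag⇒↭)
open import Data.List.Relation.Binary.Permutation.Propositional.Properties using (↭-length)
import Data.List.Relation.Unary.All as All
import Data.List.Relation.Unary.AllPairs as AllPairs
open import Data.List.Relation.Unary.Any using (here)
open import Data.List.Relation.Unary.Unique.Propositional using (Unique)
open import Data.List.Relation.Unary.Unique.Propositional.Properties
  using (cartesianProductWith⁺; filter⁺; map⁺; allFin⁺)
open import Data.Nat using (ℕ; zero; suc; _+_; _*_; _∸_; _^_; _/_; _%_; _!; _≤_; _<_; _≥_; z≤n; s≤s; ⌊_/2⌋)
open import Data.Nat.Combinatorics using (_C_; k>n⇒nCk≡0; nCk+nC[k+1]≡[n+1]C[k+1]; nC1≡n)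
open import Data.Nat.DivMod using (m*n/n≡m; m/n≡1+[m∸n]/n; m/n/o≡m/[n*o]; m≡m%n+[m/n]*n; m%n<n)
open import Data.Nat.Induction using (<-rec)
import Data.Nat.ListAction as List
open import Data.Nat.Properties
  using (+-*-semiring; +-comm; +-assoc; *-comm; *-assoc; *-identityʳ; *-distribʳ-+; *-monoʳ-≤; +-monoˡ-<;
         <-≤-trans; ≤-trans; ≤-total; m+[n∸m]≡n; m≤n*m; m≤n+m; n<1+n; m<n⇒m<1+n; m≤n⇒m≤1+n; m∸n≤m; module ≤-Reasoning)
open import Algebra.Properties.Semiring.Sum +-*-semiring
  using (sum-syntax; ∑-distrib-+; sum-replicate-zero; sum-cong-≗; *-distribˡ-sum)
open import Data.Nat.Tactic.RingSolver using (solve-∀)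
open import Data.Product using (_×_; _,_; proj₁; proj₂)
open import Data.Sum using (inj₁; inj₂; [_,_]′)
open import Data.Vec using (Vec; []; _∷_; lookup; tabulate)
open import Data.Vec.Properties using (∷-injective; lookup∘tabulate; tabulate∘lookup; tabulate-cong)
open import Function using (_∘_; id; Injective; mk⇔)
open import Function.Consequences.Propositional using (inverseʳ⇒injective; strictlyInverseʳ⇒inverseʳ)
open import Level using (0ℓ)
open import Relation.Binary.PropositionalEquality
open import Relation.Nullary using (¬_; does; contradiction)
open import Relation.Nullary.Decidable using (_×-dec_)
open import Relation.Unary using (Pred; Decidable; _∩_)
open import Relation.Unary.Properties using (_∩?_)

-- Counting words

count : ∀ {A : Set} {P : Pred A 0ℓ} → Decidable P → List A → ℕ
count P? xs = length (filter P? xs)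

indicator : Bool → ℕ
indicator b = if b then 1 else 0

count-∷ : ∀ {A : Set} {P : Pred A 0ℓ} (P? : Decidable P) x xs →
          count P? (x ∷ xs) ≡ indicator (does (P? x)) + count P? xs
count-∷ P? x xs with does (P? x)
... | true  = refl
... | false = refl

∑-indicator-≟ : ∀ {n} (a : Fin n) → ∑[ y < n ] indicator (does (a ≟ y)) ≡ 1
∑-indicator-≟ {suc n} zero    = cong suc (sum-replicate-zero n)
∑-indicator-≟ {suc n} (suc a) = ∑-indicator-≟ a

count-partition : ∀ {A : Set} {n} {P : Pred A 0ℓ} (P? : Decidable P) (F : A → Fin n) xs →
                  count P? xs ≡ ∑[ y < n ] count (P? ∩? (λ x → F x ≟ y)) xs
count-partition {n = n} {P} P? F []       = sym (sum-replicate-zero n)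
count-partition {n = n} {P} P? F (x ∷ xs) = begin
  count P? (x ∷ xs)                                                  ≡⟨ count-∷ P? x xs ⟩
  indicator (does (P? x)) + count P? xs                              ≡⟨ cong₂ _+_ (indicator-split (does (P? x)))
                                                                                  (count-partition P? F xs) ⟩
  ∑[ y < n ] indicator (does (P? x) ∧ does (F x ≟ y)) + ∑[ y < n ] count (Q? y) xs
                                                                     ≡⟨ ∑-distrib-+ {n} _ _ ⟨
  ∑[ y < n ] (indicator (does (P? x) ∧ does (F x ≟ y)) + count (Q? y) xs)
                                                                     ≡⟨ sum-cong-≗ (λ y → count-∷ (Q? y) x xs) ⟨
  ∑[ y < n ] count (Q? y) (x ∷ xs)                                   ∎
  where
  open ≡-Reasoning
  Q? : ∀ y → Decidable (P ∩ (λ x → F x ≡ y))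
  Q? y = P? ∩? (λ x → F x ≟ y)
  indicator-split : ∀ b → indicator b ≡ ∑[ y < n ] indicator (b ∧ does (F x ≟ y))
  indicator-split true  = sym (∑-indicator-≟ (F x))
  indicator-split false = sym (sum-replicate-zero n)

words-suc : ∀ {A : Set} (xs : List A) k → words xs (suc k) ≡ cartesianProductWith _∷_ xs (words xs k)
words-suc xs k = go xs
  where
  go : ∀ ys → concatMap (λ y → map (y ∷_) (words xs k)) ys ≡ cartesianProductWith _∷_ ys (words xs k)
  go []       = refl
  go (y ∷ ys) = cong (map (y ∷_) (words xs k) ++_) (go ys)

words-unique : ∀ {A : Set} {xs : List A} → Unique xs → ∀ k → Unique (words xs k)
words-unique           u zero    = All.[] AllPairs.∷ AllPairs.[]
words-unique {xs = xs} u (suc k) rewrite words-suc xs k =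
  cartesianProductWith⁺ _∷_ ∷-injective u (words-unique u k)

words-complete : ∀ {A : Set} {xs : List A} → (∀ x → x ∈ xs) → ∀ k (v : Vec A k) → v ∈ words xs k
words-complete           c zero    []      = here refl
words-complete {xs = xs} c (suc k) (x ∷ v) rewrite words-suc xs k =
  ∈-cartesianProductWith⁺ _∷_ (c x) (words-complete c k v)

allWords-unique : ∀ n → Unique (allWords n)
allWords-unique n = words-unique (allFin⁺ n) n

allWords-complete : ∀ n (w : Word n) → w ∈ allWords n
allWords-complete n = words-complete ∈-allFin n

countWords : ∀ n {P : Pred (Word n) 0ℓ} → Decidable P → ℕ
countWords n P? = count P? (allWords n)

countWords-none : ∀ n {P : Pred (Word n) 0ℓ} (P? : Decidable P) → (∀ w → ¬ P w) → countWords n P? ≡ 0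
countWords-none n P? ¬P = cong length (filter-none P? (All.universal ¬P (allWords n)))

countWords-bijection : ∀ {m n} {P : Pred (Word m) 0ℓ} {Q : Pred (Word n) 0ℓ}
  (P? : Decidable P) (Q? : Decidable Q) (g : Word m → Word n) → Injective _≡_ _≡_ g →
  (∀ v → P v → Q (g v)) → (f : Word n → Word m) → (∀ w → Q w → P (f w) × g (f w) ≡ w) →
  countWords m P? ≡ countWords n Q?
countWords-bijection {m} {n} P? Q? g g-injective g-resp f f-section = begin
  length Ps         ≡⟨ length-map g Ps ⟨
  length (map g Ps) ≡⟨ ↭-length (∼bag⇒↭ (unique∧set⇒bag image-unique Qs-unique (mk⇔ to from))) ⟩
  length Qs         ∎
  where
  open ≡-Reasoning
  Ps : List (Word m)
  Ps = filter P? (allWords m)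
  Qs : List (Word n)
  Qs = filter Q? (allWords n)
  image-unique : Unique (map g Ps)
  image-unique = map⁺ g-injective (filter⁺ P? {xs = allWords m} (allWords-unique m))
  Qs-unique : Unique Qs
  Qs-unique = filter⁺ Q? {xs = allWords n} (allWords-unique n)
  to : ∀ {w} → w ∈ map g Ps → w ∈ Qs
  to w∈ with v , v∈ , refl ← ∈-map⁻ g w∈ =
    ∈-filter⁺ Q? (allWords-complete n (g v)) (g-resp v (proj₂ (∈-filter⁻ P? {xs = allWords m} v∈)))
  from : ∀ {w} → w ∈ Qs → w ∈ map g Ps
  from {w} w∈ with Pfw , gfw≡w ← f-section w (proj₂ (∈-filter⁻ Q? {xs = allWords n} w∈)) =
    subst (_∈ map g Ps) gfw≡w (∈-map⁺ g (∈-filter⁺ P? (allWords-complete m (f w)) Pfw))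

-- Cube roots and conjugation

strictlyInverseʳ⇒injective : ∀ {A B : Set} {f : A → B} (g : B → A) → (∀ x → g (f x) ≡ x) → Injective _≡_ _≡_ f
strictlyInverseʳ⇒injective {f = f} g gf = inverseʳ⇒injective f (strictlyInverseʳ⇒inverseʳ {f⁻¹ = g} f gf)

involutive⇒injective : ∀ {A : Set} {f : A → A} → (∀ i → f (f i) ≡ i) → Injective _≡_ _≡_ f
involutive⇒injective {f = f} = strictlyInverseʳ⇒injective f

CubeRoot : ∀ {n} → (σ π : Fin n → Fin n) → Set
CubeRoot σ π = ∀ i → π (π (π i)) ≡ σ i

CubeRootWord : ∀ {n} → (Fin n → Fin n) → Word n → Set
CubeRootWord σ w = CubeRoot σ (lookup w)

cubeRoot? : ∀ {n} (σ : Fin n → Fin n) → Decidable (CubeRootWord σ)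
cubeRoot? σ w = all? λ i → lookup w (lookup w (lookup w i)) ≟ σ i

module _ {n} {σ π : Fin n → Fin n} (root : CubeRoot σ π) where

  cubeRoot-injective : Injective _≡_ _≡_ σ → Injective _≡_ _≡_ π
  cubeRoot-injective σ-injective {i} {j} πi≡πj =
    σ-injective (trans (sym (root i)) (trans (cong (π ∘ π) πi≡πj) (root j)))

  cubeRoot-comm : ∀ i → π (σ i) ≡ σ (π i)
  cubeRoot-comm i = trans (cong π (sym (root i))) (root (π i))

  cubeRoot-cong : ∀ {σ′ ρ} → σ ≗ σ′ → π ≗ ρ → CubeRoot σ′ ρ
  cubeRoot-cong {σ′} {ρ} σ≗σ′ π≗ρ i = begin
    ρ (ρ (ρ i)) ≡⟨ cong (ρ ∘ ρ) (π≗ρ i) ⟨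
    ρ (ρ (π i)) ≡⟨ cong ρ (π≗ρ (π i)) ⟨
    ρ (π (π i)) ≡⟨ π≗ρ (π (π i)) ⟨
    π (π (π i)) ≡⟨ root i ⟩
    σ i         ≡⟨ σ≗σ′ i ⟩
    σ′ i        ∎
    where open ≡-Reasoning

  cubeRoot-fixed : ∀ {x} → π x ≡ x → σ x ≡ x
  cubeRoot-fixed {x} πx≡x = trans (sym (root x)) (trans (cong (π ∘ π) πx≡x) (trans (cong π πx≡x) πx≡x))

  cubeRoot-into-fixed : Injective _≡_ _≡_ σ → ∀ {x} → σ (π x) ≡ π x → σ x ≡ x
  cubeRoot-into-fixed σ-injective {x} fixed = cubeRoot-injective σ-injective (trans (cubeRoot-comm x) fixed)

conjugate : ∀ {n} (α β : Fin n → Fin n) → Word n → Word n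
conjugate α β w = tabulate (α ∘ lookup w ∘ β)

lookup-conjugate : ∀ {n} (α β : Fin n → Fin n) w i → lookup (conjugate α β w) i ≡ α (lookup w (β i))
lookup-conjugate α β w = lookup∘tabulate (α ∘ lookup w ∘ β)

conjugate-inverse : ∀ {n} {α β : Fin n → Fin n} → (∀ i → β (α i) ≡ i) →
                    ∀ w → conjugate β α (conjugate α β w) ≡ w
conjugate-inverse {α = α} {β} βα w = trans (tabulate-cong inner) (tabulate∘lookup w)
  where
  inner : ∀ i → β (lookup (conjugate α β w) (α i)) ≡ lookup w i
  inner i rewrite lookup-conjugate α β w (α i) = trans (βα _) (cong (lookup w) (βα i))

conjugate-cubeRoot : ∀ {n} {σ σ′ : Fin n → Fin n} (α β : Fin n → Fin n) → (∀ i → β (α i) ≡ i) →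
                     (∀ i → α (σ (β i)) ≡ σ′ i) →
                     ∀ w → CubeRootWord σ w → CubeRootWord σ′ (conjugate α β w)
conjugate-cubeRoot {n} {σ} {σ′} α β βα ασβ w root =
  cubeRoot-cong conjugated (λ _ → refl) (sym ∘ lookup-conjugate α β w)
  where
  π : Fin n → Fin n
  π = lookup w
  conjugated : CubeRoot σ′ (α ∘ π ∘ β)
  conjugated i = begin
    α (π (β (α (π (β (α (π (β i)))))))) ≡⟨ cong (α ∘ π) (βα _) ⟩
    α (π (π (β (α (π (β i))))))         ≡⟨ cong (α ∘ π ∘ π) (βα _) ⟩
    α (π (π (π (β i))))                 ≡⟨ cong α (root (β i)) ⟩
    α (σ (β i))                         ≡⟨ ασβ i ⟩
    σ′ i                                ∎
    where open ≡-Reasoning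

countWords-conjugate : ∀ {n} {P Q : Pred (Word n) 0ℓ} (P? : Decidable P) (Q? : Decidable Q)
  (α β : Fin n → Fin n) → (∀ i → β (α i) ≡ i) → (∀ i → α (β i) ≡ i) →
  (∀ w → P w → Q (conjugate α β w)) → (∀ w → Q w → P (conjugate β α w)) →
  countWords n P? ≡ countWords n Q?
countWords-conjugate P? Q? α β βα αβ PQ QP =
  countWords-bijection P? Q? (conjugate α β)
    (strictlyInverseʳ⇒injective (conjugate β α) (conjugate-inverse {α = α} {β} βα)) PQ
    (conjugate β α) (λ w Qw → QP w Qw , conjugate-inverse {α = β} {α} αβ w)

swapPairs : ∀ {n} → Fin n → Fin n
swapPairs {suc zero}    zero          = zero
swapPairs {suc (suc n)} zero          = suc zero
swapPairs {suc (suc n)} (suc zero)    = zero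
swapPairs {suc (suc n)} (suc (suc i)) = suc (suc (swapPairs i))

swapPairs-involutive : ∀ {n} (i : Fin n) → swapPairs (swapPairs i) ≡ i
swapPairs-involutive {suc zero}    zero          = refl
swapPairs-involutive {suc (suc n)} zero          = refl
swapPairs-involutive {suc (suc n)} (suc zero)    = refl
swapPairs-involutive {suc (suc n)} (suc (suc i)) = cong (λ j → suc (suc j)) (swapPairs-involutive i)

swapPairs-injective : ∀ {n} → Injective _≡_ _≡_ (swapPairs {n})
swapPairs-injective = involutive⇒injective swapPairs-involutive

swapPairs-root : ∀ {n} → CubeRoot swapPairs (swapPairs {n})
swapPairs-root i = swapPairs-involutive (swapPairs i)

IsRoot : ∀ {n} → Word n → Set
IsRoot = CubeRootWord swapPairs

root? : ∀ {n} → Decidable (IsRoot {n})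
root? = cubeRoot? swapPairs

cubeRootCount : ℕ → ℕ
cubeRootCount n = countWords n root?

opposite-fromℕ : ∀ k → opposite (fromℕ k) ≡ zero
opposite-fromℕ zero    = refl
opposite-fromℕ (suc k) = cong inject₁ (opposite-fromℕ k)

opposite-inject₁ : ∀ {k} (i : Fin k) → opposite (inject₁ i) ≡ suc (opposite i)
opposite-inject₁ {suc k} zero    = refl
opposite-inject₁ {suc k} (suc i) = cong inject₁ (opposite-inject₁ i)

zigzag : ∀ {n} → Fin n → Fin n
zigzag {suc n}       zero          = zero
zigzag {suc (suc k)} (suc zero)    = fromℕ (suc k)
zigzag {suc (suc k)} (suc (suc i)) = suc (inject₁ (zigzag i))

unzigzag : ∀ {n} → Fin n → Fin n
unzigzag-suc : ∀ {k} {j : Fin (suc k)} → View j → Fin (suc (suc k))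
unzigzag {suc n}       zero    = zero
unzigzag {suc (suc k)} (suc j) = unzigzag-suc (view j)
unzigzag-suc ‵fromℕ       = suc zero
unzigzag-suc (‵inject₁ i) = suc (suc (unzigzag i))

unzigzag-zigzag : ∀ {n} (i : Fin n) → unzigzag (zigzag i) ≡ i
unzigzag-zigzag {suc n}       zero          = refl
unzigzag-zigzag {suc (suc k)} (suc zero)    rewrite view-fromℕ k = refl
unzigzag-zigzag {suc (suc k)} (suc (suc i)) rewrite view-inject₁ (zigzag i) =
  cong (λ j → suc (suc j)) (unzigzag-zigzag i)

zigzag-unzigzag : ∀ {n} (i : Fin n) → zigzag (unzigzag i) ≡ i
zigzag-unzigzag {suc n}       zero    = refl
zigzag-unzigzag {suc (suc k)} (suc j) with view j
... | ‵fromℕ       = refl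
... | ‵inject₁ i = cong (suc ∘ inject₁) (zigzag-unzigzag i)

zigzag-swapPairs : ∀ {n} (i : Fin n) → zigzag (swapPairs i) ≡ opposite (zigzag i)
zigzag-swapPairs {suc zero}    zero          = refl
zigzag-swapPairs {suc (suc k)} zero          = refl
zigzag-swapPairs {suc (suc k)} (suc zero)    = sym (cong inject₁ (opposite-fromℕ k))
zigzag-swapPairs {suc (suc k)} (suc (suc i)) = begin
  suc (inject₁ (zigzag (swapPairs i))) ≡⟨ cong (suc ∘ inject₁) (zigzag-swapPairs i) ⟩
  suc (inject₁ (opposite (zigzag i)))  ≡⟨ cong inject₁ (opposite-inject₁ (zigzag i)) ⟨
  opposite (suc (inject₁ (zigzag i)))  ∎
  where open ≡-Reasoning

countCubeRootsOfDecreasing≡cubeRootCount : ∀ n → countCubeRootsOfDecreasing n ≡ cubeRootCount n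
countCubeRootsOfDecreasing≡cubeRootCount n =
  countWords-conjugate {n} (λ w → isPerm? w ×-dec cubeIsDecreasing? w) root?
    unzigzag zigzag zigzag-unzigzag unzigzag-zigzag
    (λ w (_ , root) → conjugate-cubeRoot unzigzag zigzag zigzag-unzigzag to-swapPairs w root)
    (λ w root → let root′ = conjugate-cubeRoot zigzag unzigzag unzigzag-zigzag to-opposite w root in
      (λ i j → cubeRoot-injective root′ (involutive⇒injective opposite-involutive)) , root′)
  where
  to-swapPairs : ∀ i → unzigzag (opposite (zigzag i)) ≡ swapPairs i
  to-swapPairs i = trans (cong unzigzag (sym (zigzag-swapPairs i))) (unzigzag-zigzag (swapPairs i))
  to-opposite : ∀ i → zigzag (swapPairs (unzigzag i)) ≡ opposite i
  to-opposite i = trans (zigzag-swapPairs (unzigzag i)) (cong opposite (zigzag-unzigzag i))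

-- Block sums

data Even : ℕ → Set where
  even-0  : Even 0
  even-2+ : ∀ {m} → Even m → Even (suc (suc m))

_⊕_ : ∀ {m k} → (Fin m → Fin m) → (Fin k → Fin k) → Fin (m + k) → Fin (m + k)
_⊕_ {m} {k} p ρ i = [ (λ a → p a ↑ˡ k) , (λ b → m ↑ʳ ρ b) ]′ (splitAt m i)

lift : ∀ m {k} → (Fin k → Fin k) → Fin (m + k) → Fin (m + k)
lift m t = _⊕_ {m} id t

module _ {m k : ℕ} where

  split-cases : {P : Fin (m + k) → Set} → (∀ a → P (a ↑ˡ k)) → (∀ b → P (m ↑ʳ b)) → ∀ i → P i
  split-cases {P} left right i = subst P (join-splitAt m k i) (cases (splitAt m i))
    where
    cases : ∀ s → P (join m k s)
    cases (inj₁ a) = left a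
    cases (inj₂ b) = right b

  ↑ˡ≢↑ʳ : ∀ (a : Fin m) (b : Fin k) → a ↑ˡ k ≢ m ↑ʳ b
  ↑ˡ≢↑ʳ a b eq with () ← trans (sym (splitAt-↑ˡ m a k)) (trans (cong (splitAt m) eq) (splitAt-↑ʳ m k b))

  ⊕-↑ˡ : ∀ {p : Fin m → Fin m} {ρ : Fin k → Fin k} a → (p ⊕ ρ) (a ↑ˡ k) ≡ p a ↑ˡ k
  ⊕-↑ˡ a rewrite splitAt-↑ˡ m a k = refl

  ⊕-↑ʳ : ∀ {p : Fin m → Fin m} {ρ : Fin k → Fin k} b → (p ⊕ ρ) (m ↑ʳ b) ≡ m ↑ʳ ρ b
  ⊕-↑ʳ b rewrite splitAt-↑ʳ m k b = refl

  ⊕-congʳ : ∀ {p : Fin m → Fin m} {ρ ρ′ : Fin k → Fin k} → ρ ≗ ρ′ → p ⊕ ρ ≗ p ⊕ ρ′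
  ⊕-congʳ ρ≗ρ′ i with splitAt m i
  ... | inj₁ a = refl
  ... | inj₂ b = cong (m ↑ʳ_) (ρ≗ρ′ b)

  module _ {p : Fin m → Fin m} {ρ : Fin k → Fin k} where

    ⊕-cubeRoot : ∀ {σ₁ σ₂} → CubeRoot σ₁ p → CubeRoot σ₂ ρ → CubeRoot (σ₁ ⊕ σ₂) (p ⊕ ρ)
    ⊕-cubeRoot {σ₁} {σ₂} p-root ρ-root = split-cases left right
      where
      open ≡-Reasoning
      left : ∀ a → (p ⊕ ρ) ((p ⊕ ρ) ((p ⊕ ρ) (a ↑ˡ k))) ≡ (σ₁ ⊕ σ₂) (a ↑ˡ k)
      left a = begin
        (p ⊕ ρ) ((p ⊕ ρ) ((p ⊕ ρ) (a ↑ˡ k))) ≡⟨ cong ((p ⊕ ρ) ∘ (p ⊕ ρ)) (⊕-↑ˡ a) ⟩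
        (p ⊕ ρ) ((p ⊕ ρ) (p a ↑ˡ k))         ≡⟨ cong (p ⊕ ρ) (⊕-↑ˡ (p a)) ⟩
        (p ⊕ ρ) (p (p a) ↑ˡ k)               ≡⟨ ⊕-↑ˡ (p (p a)) ⟩
        p (p (p a)) ↑ˡ k                     ≡⟨ cong (_↑ˡ k) (p-root a) ⟩
        σ₁ a ↑ˡ k                            ≡⟨ ⊕-↑ˡ {p = σ₁} {σ₂} a ⟨
        (σ₁ ⊕ σ₂) (a ↑ˡ k)                   ∎
      right : ∀ b → (p ⊕ ρ) ((p ⊕ ρ) ((p ⊕ ρ) (m ↑ʳ b))) ≡ (σ₁ ⊕ σ₂) (m ↑ʳ b)
      right b = begin
        (p ⊕ ρ) ((p ⊕ ρ) ((p ⊕ ρ) (m ↑ʳ b))) ≡⟨ cong ((p ⊕ ρ) ∘ (p ⊕ ρ)) (⊕-↑ʳ b) ⟩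
        (p ⊕ ρ) ((p ⊕ ρ) (m ↑ʳ ρ b))         ≡⟨ cong (p ⊕ ρ) (⊕-↑ʳ (ρ b)) ⟩
        (p ⊕ ρ) (m ↑ʳ ρ (ρ b))               ≡⟨ ⊕-↑ʳ (ρ (ρ b)) ⟩
        m ↑ʳ ρ (ρ (ρ b))                     ≡⟨ cong (m ↑ʳ_) (ρ-root b) ⟩
        m ↑ʳ σ₂ b                            ≡⟨ ⊕-↑ʳ {p = σ₁} {σ₂} b ⟨
        (σ₁ ⊕ σ₂) (m ↑ʳ b)                   ∎

    cubeRoot-⊕⁻ʳ : ∀ {σ₁ σ₂} → CubeRoot (σ₁ ⊕ σ₂) (p ⊕ ρ) → CubeRoot σ₂ ρ
    cubeRoot-⊕⁻ʳ {σ₁} {σ₂} root b = ↑ʳ-injective m _ _ (begin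
      m ↑ʳ ρ (ρ (ρ b))                     ≡⟨ ⊕-↑ʳ (ρ (ρ b)) ⟨
      (p ⊕ ρ) (m ↑ʳ ρ (ρ b))               ≡⟨ cong (p ⊕ ρ) (⊕-↑ʳ (ρ b)) ⟨
      (p ⊕ ρ) ((p ⊕ ρ) (m ↑ʳ ρ b))         ≡⟨ cong ((p ⊕ ρ) ∘ (p ⊕ ρ)) (⊕-↑ʳ b) ⟨
      (p ⊕ ρ) ((p ⊕ ρ) ((p ⊕ ρ) (m ↑ʳ b))) ≡⟨ root (m ↑ʳ b) ⟩
      (σ₁ ⊕ σ₂) (m ↑ʳ b)                   ≡⟨ ⊕-↑ʳ {p = σ₁} {σ₂} b ⟩
      m ↑ʳ σ₂ b                            ∎)
      where open ≡-Reasoning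

swapPairs-↑ˡ : ∀ {m k} → Even m → ∀ (a : Fin m) → swapPairs {m + k} (a ↑ˡ k) ≡ swapPairs a ↑ˡ k
swapPairs-↑ˡ (even-2+ e) zero          = refl
swapPairs-↑ˡ (even-2+ e) (suc zero)    = refl
swapPairs-↑ˡ (even-2+ e) (suc (suc a)) = cong (λ i → suc (suc i)) (swapPairs-↑ˡ e a)

swapPairs-↑ʳ : ∀ {m k} → Even m → ∀ (b : Fin k) → swapPairs {m + k} (m ↑ʳ b) ≡ m ↑ʳ swapPairs b
swapPairs-↑ʳ even-0      b = refl
swapPairs-↑ʳ (even-2+ e) b = cong (λ i → suc (suc i)) (swapPairs-↑ʳ e b)

swapPairs-⊕ : ∀ {m k} → Even m → ∀ i → swapPairs {m + k} i ≡ (swapPairs {m} ⊕ swapPairs {k}) i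
swapPairs-⊕ e = split-cases (λ a → trans (swapPairs-↑ˡ e a) (sym (⊕-↑ˡ {p = swapPairs} {swapPairs} a)))
                            (λ b → trans (swapPairs-↑ʳ e b) (sym (⊕-↑ʳ {p = swapPairs} {swapPairs} b)))

Extends : ∀ {m k} → (Fin m → Fin m) → (Fin (m + k) → Fin (m + k)) → Set
Extends {m} {k} p π = ∀ a → π (a ↑ˡ k) ≡ p a ↑ˡ k

-- b is a junk value: for every π restricted below, π (m ↑ʳ b) lies in the second block.
restrict : ∀ m {k} → (Fin (m + k) → Fin (m + k)) → Fin k → Fin k
restrict m π b = [ (λ _ → b) , id ]′ (splitAt m (π (m ↑ʳ b)))

restrict-⊕ : ∀ {m k} {p : Fin m → Fin m} {ρ : Fin k → Fin k} {π} → π ≗ p ⊕ ρ → restrict m π ≗ ρ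
restrict-⊕ {m} {k} {p} {ρ} π≗p⊕ρ b rewrite π≗p⊕ρ (m ↑ʳ b) | ⊕-↑ʳ {p = p} {ρ} b | splitAt-↑ʳ m k (ρ b) = refl

module _ {m k : ℕ} (even : Even m) {p : Fin m → Fin m} (p-root : CubeRoot swapPairs p) where

  extension-decompose : ∀ {π} → CubeRoot swapPairs π → Extends p π → π ≗ p ⊕ restrict m π
  extension-decompose {π} π-root π-extends =
    split-cases (λ a → trans (π-extends a) (sym (⊕-↑ˡ {p = p} {restrict m π} a))) upper
    where
    p-surjective : ∀ a → p (p (p (swapPairs a))) ≡ a
    p-surjective a = trans (p-root (swapPairs a)) (swapPairs-involutive a)
    upper-to-upper : ∀ b a → π (m ↑ʳ b) ≢ a ↑ˡ k
    upper-to-upper b a eq = ↑ˡ≢↑ʳ _ b (cubeRoot-injective {π = π} π-root swapPairs-injective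
      (trans (π-extends _) (trans (cong (_↑ˡ k) (p-surjective a)) (sym eq))))
    upper : ∀ b → π (m ↑ʳ b) ≡ (p ⊕ restrict m π) (m ↑ʳ b)
    upper b with splitAt m (π (m ↑ʳ b)) in eq
    ... | inj₁ a = ⊥-elim (upper-to-upper b a (sym (splitAt⁻¹-↑ˡ eq)))
    ... | inj₂ c = trans (sym (splitAt⁻¹-↑ʳ eq))
                         (sym (trans (⊕-↑ʳ {p = p} {restrict m π} b) (cong (m ↑ʳ_) restricted)))
      where
      restricted : restrict m π b ≡ c
      restricted rewrite eq = refl

  countWords-extensions : {P : Pred (Word (m + k)) 0ℓ} (P? : Decidable P) →
    (∀ w → P w → IsRoot w × Extends p (lookup w)) →
    (∀ v → IsRoot (tabulate (p ⊕ lookup v)) → P (tabulate (p ⊕ lookup v))) →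
    countWords (m + k) P? ≡ cubeRootCount k
  countWords-extensions {P} P? P⇒extension extension⇒P = sym (countWords-bijection root? P?
    extend (strictlyInverseʳ⇒injective restriction restriction-extend) extend-root restriction section)
    where
    extend : Word k → Word (m + k)
    extend v = tabulate (p ⊕ lookup v)
    restriction : Word (m + k) → Word k
    restriction w = tabulate (restrict m (lookup w))
    restriction-extend : ∀ v → restriction (extend v) ≡ v
    restriction-extend v = trans (tabulate-cong (restrict-⊕ (lookup∘tabulate (p ⊕ lookup v)))) (tabulate∘lookup v)
    extend-root : ∀ v → IsRoot v → P (extend v)
    extend-root v root = extension⇒P v (cubeRoot-cong {π = p ⊕ lookup v} (⊕-cubeRoot {p = p} {lookup v} p-root root)
      (sym ∘ swapPairs-⊕ {m} {k} even) (sym ∘ lookup∘tabulate (p ⊕ lookup v)))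
    section : ∀ w → P w → IsRoot (restriction w) × extend (restriction w) ≡ w
    section w Pw = restriction-root , extend-restriction
      where
      π : Fin (m + k) → Fin (m + k)
      π = lookup w
      r : Fin k → Fin k
      r = restrict m π
      decompose : π ≗ p ⊕ r
      decompose = extension-decompose (proj₁ (P⇒extension w Pw)) (proj₂ (P⇒extension w Pw))
      restriction-root : IsRoot (restriction w)
      restriction-root = cubeRoot-cong {π = r} (cubeRoot-⊕⁻ʳ {p = p} {r} {swapPairs}
        (cubeRoot-cong {π = π} (proj₁ (P⇒extension w Pw)) (swapPairs-⊕ even) decompose))
        (λ _ → refl) (sym ∘ lookup∘tabulate r)
      extend-restriction : extend (restriction w) ≡ w
      extend-restriction = trans (tabulate-cong λ i → trans (⊕-congʳ {p = p} (lookup∘tabulate r) i) (sym (decompose i)))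
                                 (tabulate∘lookup w)

-- Involutions commuting with swapPairs

record IsPairSymmetry {n} (t : Fin n → Fin n) : Set where
  field
    involutive : ∀ i → t (t i) ≡ i
    commutes   : ∀ i → t (swapPairs i) ≡ swapPairs (t i)

open IsPairSymmetry

id-symmetry : ∀ {n} → IsPairSymmetry {n} id
id-symmetry = record { involutive = λ _ → refl ; commutes = λ _ → refl }

swapPairs-symmetry : ∀ {n} → IsPairSymmetry {n} swapPairs
swapPairs-symmetry = record { involutive = swapPairs-involutive ; commutes = λ _ → refl }

swapTwoPairs : Fin 4 → Fin 4
swapTwoPairs 0F = 2F
swapTwoPairs 1F = 3F
swapTwoPairs 2F = 0F
swapTwoPairs 3F = 1F

swapTwoPairs-symmetry : IsPairSymmetry swapTwoPairs
swapTwoPairs-symmetry = record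
  { involutive = λ { 0F → refl ; 1F → refl ; 2F → refl ; 3F → refl }
  ; commutes   = λ { 0F → refl ; 1F → refl ; 2F → refl ; 3F → refl }
  }

conjugate-symmetry : ∀ {n} {s t : Fin n → Fin n} → IsPairSymmetry s → IsPairSymmetry t → IsPairSymmetry (s ∘ t ∘ s)
conjugate-symmetry {s = s} {t} S T = record
  { involutive = λ i → trans (cong (s ∘ t) (involutive S (t (s i))))
                             (trans (cong s (involutive T (s i))) (involutive S i))
  ; commutes   = λ i → trans (cong (s ∘ t) (commutes S i))
                             (trans (cong s (commutes T (s i))) (commutes S (t (s i))))
  }

⊕-symmetry : ∀ {m k} {p : Fin m → Fin m} {t : Fin k → Fin k} → Even m →
             IsPairSymmetry p → IsPairSymmetry t → IsPairSymmetry (p ⊕ t)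
⊕-symmetry {m} {k} {p} {t} even S T = record
  { involutive = split-cases
      (λ a → trans (cong (p ⊕ t) (⊕-↑ˡ a)) (trans (⊕-↑ˡ (p a)) (cong (_↑ˡ k) (involutive S a))))
      (λ b → trans (cong (p ⊕ t) (⊕-↑ʳ b)) (trans (⊕-↑ʳ (t b)) (cong (m ↑ʳ_) (involutive T b))))
  ; commutes   = split-cases left right
  }
  where
  open ≡-Reasoning
  left : ∀ a → (p ⊕ t) (swapPairs (a ↑ˡ k)) ≡ swapPairs ((p ⊕ t) (a ↑ˡ k))
  left a = begin
    (p ⊕ t) (swapPairs (a ↑ˡ k)) ≡⟨ cong (p ⊕ t) (swapPairs-↑ˡ even a) ⟩
    (p ⊕ t) (swapPairs a ↑ˡ k)   ≡⟨ ⊕-↑ˡ (swapPairs a) ⟩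
    p (swapPairs a) ↑ˡ k         ≡⟨ cong (_↑ˡ k) (commutes S a) ⟩
    swapPairs (p a) ↑ˡ k         ≡⟨ swapPairs-↑ˡ even (p a) ⟨
    swapPairs (p a ↑ˡ k)         ≡⟨ cong swapPairs (⊕-↑ˡ a) ⟨
    swapPairs ((p ⊕ t) (a ↑ˡ k)) ∎
  right : ∀ b → (p ⊕ t) (swapPairs (m ↑ʳ b)) ≡ swapPairs ((p ⊕ t) (m ↑ʳ b))
  right b = begin
    (p ⊕ t) (swapPairs (m ↑ʳ b)) ≡⟨ cong (p ⊕ t) (swapPairs-↑ʳ even b) ⟩
    (p ⊕ t) (m ↑ʳ swapPairs b)   ≡⟨ ⊕-↑ʳ (swapPairs b) ⟩
    m ↑ʳ t (swapPairs b)         ≡⟨ cong (m ↑ʳ_) (commutes T b) ⟩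
    m ↑ʳ swapPairs (t b)         ≡⟨ swapPairs-↑ʳ even (t b) ⟨
    swapPairs (m ↑ʳ t b)         ≡⟨ cong swapPairs (⊕-↑ʳ b) ⟨
    swapPairs ((p ⊕ t) (m ↑ʳ b)) ∎

lift-symmetry : ∀ {m k} {t : Fin k → Fin k} → Even m → IsPairSymmetry t → IsPairSymmetry (lift m t)
lift-symmetry even = ⊕-symmetry even id-symmetry

-- The last point of Fin 3 is fixed by swapPairs, so the value of toFront there is never used.
toFront : ∀ {n} → Fin n → Fin n → Fin n
toFront {suc n}             zero             = id
toFront {suc (suc n)}       (suc zero)       = swapPairs
toFront {suc (suc (suc zero))} (suc (suc zero)) = id
toFront {suc (suc (suc (suc n)))} (suc (suc j)) = lift 2 (toFront j) ∘ (swapTwoPairs ⊕ id) ∘ lift 2 (toFront j)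

toFront-symmetry : ∀ {n} (j : Fin n) → IsPairSymmetry (toFront j)
toFront-symmetry {suc n}             zero             = id-symmetry
toFront-symmetry {suc (suc n)}       (suc zero)       = swapPairs-symmetry
toFront-symmetry {suc (suc (suc zero))} (suc (suc zero)) = id-symmetry
toFront-symmetry {suc (suc (suc (suc n)))} (suc (suc j)) =
  conjugate-symmetry (lift-symmetry (even-2+ even-0) (toFront-symmetry j))
                     (⊕-symmetry (even-2+ (even-2+ even-0)) swapTwoPairs-symmetry id-symmetry)

toFront-moved : ∀ {n} (j : Fin (suc n)) → swapPairs j ≢ j → toFront j j ≡ zero
toFront-moved                     zero             _     = refl
toFront-moved {suc n}             (suc zero)       _     = refl
toFront-moved {suc (suc zero)}    (suc (suc zero)) moved = ⊥-elim (moved refl)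
toFront-moved {suc (suc (suc n))} (suc (suc j))    moved =
  cong (λ x → lift 2 (toFront j) ((swapTwoPairs ⊕ id) (suc (suc x))))
       (toFront-moved j (moved ∘ cong (λ x → suc (suc x))))

toFront-zero : ∀ {n} (j : Fin (suc n)) → swapPairs j ≢ j → toFront j zero ≡ j
toFront-zero j moved = trans (cong (toFront j) (sym (toFront-moved j moved))) (involutive (toFront-symmetry j) j)

symmetry-preserves-root : ∀ {n} {t : Fin n → Fin n} → IsPairSymmetry t → ∀ w → IsRoot w → IsRoot (conjugate t t w)
symmetry-preserves-root {t = t} T = conjugate-cubeRoot t t (involutive T)
  (λ i → trans (commutes T (t i)) (cong swapPairs (involutive T i)))

-- The recurrence for cubeRootCount

_↦_ : ∀ {n} → Fin n → Fin n → Word n → Set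
(x ↦ y) w = lookup w x ≡ y

_↦?_ : ∀ {n} (x y : Fin n) → Decidable (x ↦ y)
(x ↦? y) w = lookup w x ≟ y

∑-swapPairs : ∀ n {h : Fin n → ℕ} K → (∀ j → swapPairs j ≡ j → h j ≡ 0) → (∀ j → swapPairs j ≢ j → h j ≡ K) →
              ∑[ j < n ] h j ≡ 2 * ⌊ n /2⌋ * K
∑-swapPairs zero          K fixed moved = refl
∑-swapPairs (suc zero)    K fixed moved = cong (_+ 0) (fixed zero refl)
∑-swapPairs (suc (suc n)) {h} K fixed moved = begin
  h 0F + (h 1F + ∑[ j < n ] h (suc (suc j))) ≡⟨ cong₂ (λ x y → x + (y + _)) (moved 0F λ ()) (moved 1F λ ()) ⟩
  K + (K + ∑[ j < n ] h (suc (suc j)))       ≡⟨ cong (λ x → K + (K + x)) rest ⟩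
  K + (K + 2 * ⌊ n /2⌋ * K)                  ≡⟨ regroup K ⌊ n /2⌋ ⟩
  2 * suc ⌊ n /2⌋ * K                        ∎
  where
  open ≡-Reasoning
  rest : ∑[ j < n ] h (suc (suc j)) ≡ 2 * ⌊ n /2⌋ * K
  rest = ∑-swapPairs n K (λ j eq → fixed (suc (suc j)) (cong (λ x → suc (suc x)) eq))
                         (λ j ne → moved (suc (suc j)) (ne ∘ suc-injective ∘ suc-injective))
  regroup : ∀ K m → K + (K + 2 * m * K) ≡ 2 * suc m * K
  regroup = solve-∀

hexacycle : Fin 6 → Fin 6
hexacycle 0F = 2F
hexacycle 1F = 3F
hexacycle 2F = 4F
hexacycle 3F = 5F
hexacycle 4F = 1F
hexacycle 5F = 0F

hexacycle-root : CubeRoot swapPairs hexacycle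
hexacycle-root 0F = refl
hexacycle-root 1F = refl
hexacycle-root 2F = refl
hexacycle-root 3F = refl
hexacycle-root 4F = refl
hexacycle-root 5F = refl

module _ {n : ℕ} where

  roots-0↦0 : countWords (2 + n) (root? ∩? (0F ↦? 0F)) ≡ 0
  roots-0↦0 = countWords-none (2 + n) (root? ∩? (0F ↦? 0F))
    λ w (root , π0≡0) → contradiction (cubeRoot-fixed {π = lookup w} root π0≡0) λ ()

  roots-0↦1 : countWords (2 + n) (root? ∩? (0F ↦? 1F)) ≡ cubeRootCount n
  roots-0↦1 = countWords-extensions (even-2+ even-0) swapPairs-root (root? ∩? (0F ↦? 1F))
    (λ w (root , π0≡1) → root , extends w root π0≡1) (λ _ root → root , refl)
    where
    extends : ∀ w → IsRoot w → (0F ↦ 1F) w → Extends {k = n} swapPairs (lookup w)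
    extends w root π0≡1 0F = π0≡1
    extends w root π0≡1 1F = trans (cubeRoot-comm {π = lookup w} root 0F) (cong swapPairs π0≡1)

  roots-0↦[2+j]≡roots-0↦2 : ∀ (j : Fin (2 + n)) → swapPairs j ≢ j →
    countWords (4 + n) (root? ∩? (0F ↦? suc (suc j))) ≡ countWords (4 + n) (root? ∩? (0F ↦? 2F))
  roots-0↦[2+j]≡roots-0↦2 j moved =
    countWords-conjugate (root? ∩? (0F ↦? suc (suc j))) (root? ∩? (0F ↦? 2F)) t t
      (involutive T) (involutive T) forward backward
    where
    t : Fin (4 + n) → Fin (4 + n)
    t = lift 2 (toFront j)
    T : IsPairSymmetry t
    T = lift-symmetry (even-2+ even-0) (toFront-symmetry j)
    forward : ∀ w → (IsRoot ∩ (0F ↦ suc (suc j))) w → (IsRoot ∩ (0F ↦ 2F)) (conjugate t t w)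
    forward w (root , π0≡j) = symmetry-preserves-root T w root
      , trans (lookup-conjugate t t w 0F) (trans (cong t π0≡j) (cong (λ x → suc (suc x)) (toFront-moved j moved)))
    backward : ∀ w → (IsRoot ∩ (0F ↦ 2F)) w → (IsRoot ∩ (0F ↦ suc (suc j))) (conjugate t t w)
    backward w (root , π0≡2) = symmetry-preserves-root T w root
      , trans (lookup-conjugate t t w 0F) (trans (cong t π0≡2) (cong (λ x → suc (suc x)) (toFront-zero j moved)))

  roots-0↦2-2↦[4+z]≡roots-0↦2-2↦4 : ∀ (z : Fin (2 + n)) → swapPairs z ≢ z →
    countWords (6 + n) ((root? ∩? (0F ↦? 2F)) ∩? (2F ↦? suc (suc (suc (suc z)))))
      ≡ countWords (6 + n) ((root? ∩? (0F ↦? 2F)) ∩? (2F ↦? 4F))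
  roots-0↦2-2↦[4+z]≡roots-0↦2-2↦4 z moved =
    countWords-conjugate ((root? ∩? (0F ↦? 2F)) ∩? (2F ↦? 4+ z)) ((root? ∩? (0F ↦? 2F)) ∩? (2F ↦? 4F)) t t
      (involutive T) (involutive T) forward backward
    where
    4+ : ∀ {k} → Fin k → Fin (4 + k)
    4+ x = suc (suc (suc (suc x)))
    t : Fin (6 + n) → Fin (6 + n)
    t = lift 4 (toFront z)
    T : IsPairSymmetry t
    T = lift-symmetry (even-2+ (even-2+ even-0)) (toFront-symmetry z)
    keeps-0↦2 : ∀ w → (0F ↦ 2F) w → (0F ↦ 2F) (conjugate t t w)
    keeps-0↦2 w π0≡2 = trans (lookup-conjugate t t w 0F) (cong t π0≡2)
    forward : ∀ w → ((IsRoot ∩ (0F ↦ 2F)) ∩ (2F ↦ 4+ z)) w → ((IsRoot ∩ (0F ↦ 2F)) ∩ (2F ↦ 4F)) (conjugate t t w)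
    forward w ((root , π0≡2) , π2≡z) = (symmetry-preserves-root T w root , keeps-0↦2 w π0≡2)
      , trans (lookup-conjugate t t w 2F) (trans (cong t π2≡z) (cong 4+ (toFront-moved z moved)))
    backward : ∀ w → ((IsRoot ∩ (0F ↦ 2F)) ∩ (2F ↦ 4F)) w → ((IsRoot ∩ (0F ↦ 2F)) ∩ (2F ↦ 4+ z)) (conjugate t t w)
    backward w ((root , π0≡2) , π2≡4) = (symmetry-preserves-root T w root , keeps-0↦2 w π0≡2)
      , trans (lookup-conjugate t t w 2F) (trans (cong t π2≡4) (cong 4+ (toFront-zero z moved)))

  roots-0↦2-2↦4 : countWords (6 + n) ((root? ∩? (0F ↦? 2F)) ∩? (2F ↦? 4F)) ≡ cubeRootCount n
  roots-0↦2-2↦4 = countWords-extensions (even-2+ (even-2+ (even-2+ even-0))) hexacycle-root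
    ((root? ∩? (0F ↦? 2F)) ∩? (2F ↦? 4F))
    (λ w ((root , π0≡2) , π2≡4) → root , extends w root π0≡2 π2≡4) (λ _ root → (root , refl) , refl)
    where
    extends : ∀ w → IsRoot w → (0F ↦ 2F) w → (2F ↦ 4F) w → Extends {k = n} hexacycle (lookup w)
    extends w root π0≡2 π2≡4 = λ where
        0F → π0≡2
        1F → trans (comm 0F) (cong swapPairs π0≡2)
        2F → π2≡4
        3F → trans (comm 2F) (cong swapPairs π2≡4)
        4F → π4≡1
        5F → trans (comm 4F) (cong swapPairs π4≡1)
      where
      π : Fin (6 + n) → Fin (6 + n)
      π = lookup w
      comm : ∀ i → π (swapPairs i) ≡ swapPairs (π i)
      comm = cubeRoot-comm {π = π} root
      π4≡1 : π 4F ≡ 1F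
      π4≡1 = trans (cong π (sym π2≡4)) (trans (cong (π ∘ π) (sym π0≡2)) (root 0F))

roots-0↦2-2↦moved : ∀ n (z : Fin n) → swapPairs z ≢ z →
  countWords (4 + n) ((root? ∩? (0F ↦? 2F)) ∩? (2F ↦? suc (suc (suc (suc z))))) ≡ cubeRootCount (n ∸ 2)
roots-0↦2-2↦moved (suc zero)    zero moved = contradiction refl moved
roots-0↦2-2↦moved (suc (suc n)) z    moved = trans (roots-0↦2-2↦[4+z]≡roots-0↦2-2↦4 z moved) (roots-0↦2-2↦4 {n})

roots-0↦2 : ∀ n → countWords (4 + n) (root? ∩? (0F ↦? 2F)) ≡ 2 * ⌊ n /2⌋ * cubeRootCount (n ∸ 2)
roots-0↦2 n = begin
  countWords (4 + n) (root? ∩? (0F ↦? 2F))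
    ≡⟨ count-partition (root? ∩? (0F ↦? 2F)) (λ w → lookup w 2F) (allWords (4 + n)) ⟩
  X 0F + (X 1F + (X 2F + (X 3F + ∑[ z < n ] X (suc (suc (suc (suc z)))))))
    ≡⟨ cong₂ _+_ (none not-0) (cong₂ _+_ (none not-1) (cong₂ _+_ (none not-2) (cong₂ _+_ (none not-3)
         (∑-swapPairs n (cubeRootCount (n ∸ 2)) fixed (roots-0↦2-2↦moved n))))) ⟩
  2 * ⌊ n /2⌋ * cubeRootCount (n ∸ 2) ∎
  where
  open ≡-Reasoning
  X : Fin (4 + n) → ℕ
  X y = countWords (4 + n) ((root? ∩? (0F ↦? 2F)) ∩? (2F ↦? y))
  Impossible : Fin (4 + n) → Set
  Impossible y = ∀ w → IsRoot w → (0F ↦ 2F) w → ¬ (2F ↦ y) w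
  none : ∀ {y} → Impossible y → X y ≡ 0
  none {y} impossible = countWords-none (4 + n) ((root? ∩? (0F ↦? 2F)) ∩? (2F ↦? y))
    λ w ((root , π0≡2) , π2≡y) → impossible w root π0≡2 π2≡y
  π²2≡1 : ∀ w → IsRoot w → (0F ↦ 2F) w → lookup w (lookup w 2F) ≡ 1F
  π²2≡1 w root π0≡2 = trans (cong (lookup w ∘ lookup w) (sym π0≡2)) (root 0F)
  not-0 : Impossible 0F
  not-0 w root π0≡2 π2≡0 = contradiction (trans (sym (π²2≡1 w root π0≡2)) (trans (cong (lookup w) π2≡0) π0≡2)) λ ()
  not-1 : Impossible 1F
  not-1 w root π0≡2 π2≡1 = contradiction
    (cubeRoot-fixed {π = lookup w} root (trans (cong (lookup w) (sym π2≡1)) (π²2≡1 w root π0≡2))) λ ()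
  not-2 : Impossible 2F
  not-2 w root π0≡2 π2≡2 = contradiction (cubeRoot-fixed {π = lookup w} root π2≡2) λ ()
  not-3 : Impossible 3F
  not-3 w root π0≡2 π2≡3 = contradiction
    (trans (sym (trans (cubeRoot-comm {π = lookup w} root 2F) (cong swapPairs π2≡3)))
           (trans (cong (lookup w) (sym π2≡3)) (π²2≡1 w root π0≡2))) λ ()
  fixed : ∀ z → swapPairs z ≡ z → X (suc (suc (suc (suc z)))) ≡ 0
  fixed z z-fixed = none λ w root π0≡2 π2≡z → contradiction
    (cubeRoot-into-fixed {π = lookup w} root swapPairs-injective
      (trans (cong swapPairs π2≡z) (trans (cong (λ x → suc (suc (suc (suc x)))) z-fixed) (sym π2≡z)))) λ ()

roots-0↦fixed : ∀ {n} (j : Fin n) → swapPairs j ≡ j → countWords (2 + n) (root? ∩? (0F ↦? suc (suc j))) ≡ 0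
roots-0↦fixed {n} j j-fixed = countWords-none (2 + n) (root? ∩? (0F ↦? suc (suc j))) λ w (root , π0≡j) →
  contradiction (cubeRoot-into-fixed {π = lookup w} root swapPairs-injective
    (trans (cong swapPairs π0≡j) (trans (cong (λ x → suc (suc x)) j-fixed) (sym π0≡j)))) λ ()

roots-0↦moved : ∀ n (j : Fin n) → swapPairs j ≢ j →
  countWords (2 + n) (root? ∩? (0F ↦? suc (suc j))) ≡ 2 * ⌊ n ∸ 2 /2⌋ * cubeRootCount (n ∸ 4)
roots-0↦moved (suc zero)    zero moved = contradiction refl moved
roots-0↦moved (suc (suc n)) j    moved = trans (roots-0↦[2+j]≡roots-0↦2 j moved) (roots-0↦2 n)

cubeRootCount-rec : ∀ n → cubeRootCount (2 + n) ≡
  cubeRootCount n + 4 * ⌊ n /2⌋ * ⌊ n ∸ 2 /2⌋ * cubeRootCount (n ∸ 4)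
cubeRootCount-rec n = begin
  cubeRootCount (2 + n)
    ≡⟨ count-partition root? (λ w → lookup w 0F) (allWords (2 + n)) ⟩
  Y 0F + (Y 1F + ∑[ j < n ] Y (suc (suc j)))
    ≡⟨ cong₂ _+_ (roots-0↦0 {n}) (cong₂ _+_ (roots-0↦1 {n}) (∑-swapPairs n _ roots-0↦fixed (roots-0↦moved n))) ⟩
  cubeRootCount n + 2 * ⌊ n /2⌋ * (2 * ⌊ n ∸ 2 /2⌋ * cubeRootCount (n ∸ 4))
    ≡⟨ cong (cubeRootCount n +_) (regroup ⌊ n /2⌋ ⌊ n ∸ 2 /2⌋ (cubeRootCount (n ∸ 4))) ⟩
  cubeRootCount n + 4 * ⌊ n /2⌋ * ⌊ n ∸ 2 /2⌋ * cubeRootCount (n ∸ 4) ∎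
  where
  open ≡-Reasoning
  Y : Fin (2 + n) → ℕ
  Y y = countWords (2 + n) (root? ∩? (0F ↦? y))
  regroup : ∀ a b c → 2 * a * (2 * b * c) ≡ 4 * a * b * c
  regroup = solve-∀
-- The closed formula

threeCycleCount : ℕ → ℕ
threeCycleCount zero    = 1
threeCycleCount (suc i) = (2 + 3 * i) * (1 + 3 * i) * threeCycleCount i

3*suc : ∀ i → 3 * suc i ≡ 3 + 3 * i
3*suc = solve-∀

[3i]!≡threeCycleCount*denom : ∀ i → (3 * i) ! ≡ threeCycleCount i * denom i
[3i]!≡threeCycleCount*denom zero    = refl
[3i]!≡threeCycleCount*denom (suc i) = begin
  (3 * suc i) !                                           ≡⟨ cong _! (3*suc i) ⟩
  (3 + 3 * i) * ((2 + 3 * i) * ((1 + 3 * i) * (3 * i) !))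
    ≡⟨ cong (λ x → (3 + 3 * i) * ((2 + 3 * i) * ((1 + 3 * i) * x))) ([3i]!≡threeCycleCount*denom i) ⟩
  (3 + 3 * i) * ((2 + 3 * i) * ((1 + 3 * i) * (threeCycleCount i * (i ! * 3 ^ i))))
    ≡⟨ regroup i (threeCycleCount i) (i !) (3 ^ i) ⟩
  threeCycleCount (suc i) * denom (suc i)                 ∎
  where
  open ≡-Reasoning
  regroup : ∀ i c f p → (3 + 3 * i) * ((2 + 3 * i) * ((1 + 3 * i) * (c * (f * p)))) ≡
                        ((2 + 3 * i) * (1 + 3 * i) * c) * ((suc i * f) * (3 * p))
  regroup = solve-∀

[3i]!/denom≡threeCycleCount : ∀ i → ((3 * i) ! / denom i) ⦃ denom≢0 i ⦄ ≡ threeCycleCount i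
[3i]!/denom≡threeCycleCount i =
  trans (cong (λ x → (x / denom i) ⦃ denom≢0 i ⦄) ([3i]!≡threeCycleCount*denom i))
        (m*n/n≡m (threeCycleCount i) (denom i) ⦃ denom≢0 i ⦄)

C-absorption : ∀ n k → (suc n C suc k) * suc k ≡ suc n * (n C k)
C-absorption zero    zero    = refl
C-absorption zero    (suc k) rewrite k>n⇒nCk≡0 {0} {suc k} (s≤s z≤n) = refl
C-absorption (suc n) zero    = trans (*-identityʳ _) (trans (nC1≡n (suc (suc n))) (sym (*-identityʳ (suc (suc n)))))
C-absorption (suc n) (suc k) = begin
  (suc (suc n) C suc (suc k)) * suc (suc k) ≡⟨ cong (_* suc (suc k)) (nCk+nC[k+1]≡[n+1]C[k+1] (suc n) (suc k)) ⟨
  (X + Y) * suc (suc k)                     ≡⟨ split X Y k ⟩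
  X * suc k + X + Y * suc (suc k)           ≡⟨ cong₂ (λ u v → u + X + v) (C-absorption n k) (C-absorption n (suc k)) ⟩
  suc n * (n C k) + X + suc n * (n C suc k) ≡⟨ merge (suc n) (n C k) X (n C suc k) ⟩
  suc n * ((n C k) + (n C suc k)) + X       ≡⟨ cong (λ u → suc n * u + X) (nCk+nC[k+1]≡[n+1]C[k+1] n k) ⟩
  suc n * X + X                             ≡⟨ +-comm (suc n * X) X ⟩
  suc (suc n) * X                           ∎
  where
  open ≡-Reasoning
  X Y : ℕ
  X = suc n C suc k
  Y = suc n C suc (suc k)
  split : ∀ X Y k → (X + Y) * suc (suc k) ≡ X * suc k + X + Y * suc (suc k)
  split = solve-∀
  merge : ∀ a b X c → a * b + X + a * c ≡ a * (b + c) + X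
  merge = solve-∀

C-absorption₂ : ∀ a k → (suc (suc a) C suc (suc k)) * (suc (suc k) * suc k) ≡ suc (suc a) * suc a * (a C k)
C-absorption₂ a k = begin
  (suc (suc a) C suc (suc k)) * (suc (suc k) * suc k) ≡⟨ *-assoc (suc (suc a) C suc (suc k)) (suc (suc k)) (suc k) ⟨
  (suc (suc a) C suc (suc k)) * suc (suc k) * suc k   ≡⟨ cong (_* suc k) (C-absorption (suc a) (suc k)) ⟩
  suc (suc a) * (suc a C suc k) * suc k               ≡⟨ *-assoc (suc (suc a)) (suc a C suc k) (suc k) ⟩
  suc (suc a) * ((suc a C suc k) * suc k)             ≡⟨ cong (suc (suc a) *_) (C-absorption a k) ⟩
  suc (suc a) * (suc a * (a C k))                     ≡⟨ *-assoc (suc (suc a)) (suc a) (a C k) ⟨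
  suc (suc a) * suc a * (a C k)                       ∎
  where open ≡-Reasoning

summand : ℕ → ℕ → ℕ
summand m i = (m C (3 * i)) * (threeCycleCount i * 4 ^ i)

term≡summand : ∀ n i → term n i ≡ summand (n / 2) i
term≡summand n i = cong (λ x → ((n / 2) C (3 * i)) * (x * 4 ^ i)) ([3i]!/denom≡threeCycleCount i)

summand-rec : ∀ a i → summand (3 + a) (suc i) ≡ summand (2 + a) (suc i) + 4 * (2 + a) * (1 + a) * summand a i
summand-rec a i = begin
  ((3 + a) C (3 * suc i)) * W ≡⟨ cong (λ k → ((3 + a) C k) * W) (3*suc i) ⟩
  ((3 + a) C (3 + 3 * i)) * W ≡⟨ cong (_* W) (nCk+nC[k+1]≡[n+1]C[k+1] (2 + a) (2 + 3 * i)) ⟨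
  (X + Y) * W                 ≡⟨ *-distribʳ-+ W X Y ⟩
  X * W + Y * W               ≡⟨ +-comm (X * W) (Y * W) ⟩
  Y * W + X * W               ≡⟨ cong₂ _+_ (sym (cong (λ k → ((2 + a) C k) * W) (3*suc i)))
                                           (regroup X (2 + 3 * i) (1 + 3 * i) (threeCycleCount i) (4 ^ i)) ⟩
  summand (2 + a) (suc i) + (X * ((2 + 3 * i) * (1 + 3 * i))) * (4 * G)
    ≡⟨ cong (λ u → summand (2 + a) (suc i) + u * (4 * G)) (C-absorption₂ a (3 * i)) ⟩
  summand (2 + a) (suc i) + ((2 + a) * (1 + a) * (a C (3 * i))) * (4 * G)
    ≡⟨ cong (summand (2 + a) (suc i) +_) (regroup′ (2 + a) (1 + a) (a C (3 * i)) G) ⟩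
  summand (2 + a) (suc i) + 4 * (2 + a) * (1 + a) * summand a i ∎
  where
  open ≡-Reasoning
  W G X Y : ℕ
  W = threeCycleCount (suc i) * 4 ^ suc i
  G = threeCycleCount i * 4 ^ i
  X = (2 + a) C (2 + 3 * i)
  Y = (2 + a) C (3 + 3 * i)
  regroup : ∀ x y z c p → x * ((y * z * c) * (4 * p)) ≡ (x * (y * z)) * (4 * (c * p))
  regroup = solve-∀
  regroup′ : ∀ p q c r → (p * q * c) * (4 * r) ≡ 4 * p * q * (c * r)
  regroup′ = solve-∀

sumTo : ℕ → (ℕ → ℕ) → ℕ
sumTo K f = ∑[ i < K ] f (toℕ i)

sumTo-vanishing-tail : ∀ K j (f : ℕ → ℕ) → (∀ i → K ≤ i → f i ≡ 0) → sumTo (K + j) f ≡ sumTo K f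
sumTo-vanishing-tail zero    j f vanish = trans (sum-cong-≗ {j} (λ i → vanish (toℕ i) z≤n)) (sum-replicate-zero j)
sumTo-vanishing-tail (suc K) j f vanish =
  cong (f 0 +_) (sumTo-vanishing-tail K j (f ∘ suc) (λ i K≤i → vanish (suc i) (s≤s K≤i)))

formulaInPairs : ℕ → ℕ
formulaInPairs m = sumTo (suc m) (summand m)

summand-vanishes : ∀ m {K} → m < 3 * K → ∀ i → K ≤ i → summand m i ≡ 0
summand-vanishes m m<3K i K≤i = cong (_* _) (k>n⇒nCk≡0 (<-≤-trans m<3K (*-monoʳ-≤ 3 K≤i)))

sumTo-summand : ∀ m K → m < 3 * K → sumTo K (summand m) ≡ formulaInPairs m
sumTo-summand m K m<3K with ≤-total K (suc m)
... | inj₁ K≤1+m = sym (trans (cong (λ L → sumTo L (summand m)) (sym (m+[n∸m]≡n K≤1+m)))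
                              (sumTo-vanishing-tail K _ (summand m) (summand-vanishes m m<3K)))
... | inj₂ 1+m≤K = trans (cong (λ L → sumTo L (summand m)) (sym (m+[n∸m]≡n 1+m≤K)))
                         (sumTo-vanishing-tail (suc m) _ (summand m) (summand-vanishes m (m≤n*m (suc m) 3)))

formulaInPairs-rec : ∀ m → formulaInPairs (3 + m) ≡ formulaInPairs (2 + m) + 4 * (2 + m) * (1 + m) * formulaInPairs m
formulaInPairs-rec m = begin
  summand (3 + m) 0 + sumTo (3 + m) (summand (3 + m) ∘ suc)
    ≡⟨ cong (summand (2 + m) 0 +_) (sum-cong-≗ {3 + m} (summand-rec m ∘ toℕ)) ⟩
  summand (2 + m) 0 + sumTo (3 + m) (λ i → summand (2 + m) (suc i) + c * summand m i)
    ≡⟨ cong (summand (2 + m) 0 +_) (∑-distrib-+ {3 + m} (summand (2 + m) ∘ suc ∘ toℕ) (λ i → c * summand m (toℕ i))) ⟩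
  summand (2 + m) 0 + (sumTo (3 + m) (summand (2 + m) ∘ suc) + sumTo (3 + m) (λ i → c * summand m i))
    ≡⟨ +-assoc (summand (2 + m) 0) (sumTo (3 + m) (summand (2 + m) ∘ suc)) (sumTo (3 + m) (λ i → c * summand m i)) ⟨
  sumTo (4 + m) (summand (2 + m)) + sumTo (3 + m) (λ i → c * summand m i)
    ≡⟨ cong₂ _+_ (sumTo-summand (2 + m) (4 + m) (<3* (m≤n+m (3 + m) 1)))
                 (sym (*-distribˡ-sum {3 + m} c (summand m ∘ toℕ))) ⟩
  formulaInPairs (2 + m) + c * sumTo (3 + m) (summand m)
    ≡⟨ cong (λ x → formulaInPairs (2 + m) + c * x) (sumTo-summand m (3 + m) (<3* (m≤n+m (1 + m) 2))) ⟩
  formulaInPairs (2 + m) + c * formulaInPairs m ∎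
  where
  open ≡-Reasoning
  c : ℕ
  c = 4 * (2 + m) * (1 + m)
  <3* : ∀ {a K} → suc a ≤ K → a < 3 * K
  <3* {K = K} 1+a≤K = ≤-trans 1+a≤K (m≤n*m K 3)

formulaInPairs-half-rec : ∀ n → formulaInPairs ⌊ 2 + n /2⌋ ≡
  formulaInPairs ⌊ n /2⌋ + 4 * ⌊ n /2⌋ * ⌊ n ∸ 2 /2⌋ * formulaInPairs ⌊ n ∸ 4 /2⌋
formulaInPairs-half-rec 0 = refl
formulaInPairs-half-rec 1 = refl
formulaInPairs-half-rec 2 = refl
formulaInPairs-half-rec 3 = refl
formulaInPairs-half-rec (suc (suc (suc (suc n)))) = formulaInPairs-rec ⌊ n /2⌋

⌊n/2⌋≡n/2 : ∀ n → ⌊ n /2⌋ ≡ n / 2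
⌊n/2⌋≡n/2 zero          = refl
⌊n/2⌋≡n/2 (suc zero)    = refl
⌊n/2⌋≡n/2 (suc (suc n)) = trans (cong suc (⌊n/2⌋≡n/2 n)) (sym (m/n≡1+[m∸n]/n {suc (suc n)} {2} (s≤s (s≤s z≤n))))

n/2<3*[1+n/6] : ∀ n → n / 2 < 3 * suc (n / 6)
n/2<3*[1+n/6] n = subst (λ q → n / 2 < 3 * suc q) (m/n/o≡m/[n*o] n 2 3) (begin-strict
  m                 ≡⟨ m≡m%n+[m/n]*n m 3 ⟩
  m % 3 + m / 3 * 3 <⟨ +-monoˡ-< (m / 3 * 3) (m%n<n m 3) ⟩
  3 + m / 3 * 3     ≡⟨ *-comm (suc (m / 3)) 3 ⟩
  3 * suc (m / 3)   ∎)
  where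
  open ≤-Reasoning
  m : ℕ
  m = n / 2

sum-applyUpTo : ∀ K (f g : ℕ → ℕ) → List.sum (map f (applyUpTo g K)) ≡ sumTo K (f ∘ g)
sum-applyUpTo zero    f g = refl
sum-applyUpTo (suc K) f g = cong (f (g 0) +_) (sum-applyUpTo K f (g ∘ suc))

formula≡formulaInPairs : ∀ n → formula n ≡ formulaInPairs ⌊ n /2⌋
formula≡formulaInPairs n = begin
  formula n                              ≡⟨ sum-applyUpTo (suc (n / 6)) (term n) id ⟩
  sumTo (suc (n / 6)) (term n)           ≡⟨ sum-cong-≗ {suc (n / 6)} (term≡summand n ∘ toℕ) ⟩
  sumTo (suc (n / 6)) (summand (n / 2))  ≡⟨ sumTo-summand (n / 2) (suc (n / 6)) (n/2<3*[1+n/6] n) ⟩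
  formulaInPairs (n / 2)                 ≡⟨ cong formulaInPairs (⌊n/2⌋≡n/2 n) ⟨
  formulaInPairs ⌊ n /2⌋                 ∎
  where open ≡-Reasoning

recurrence-unique : ∀ (a : ℕ → ℕ) {u v : ℕ → ℕ} → u 0 ≡ v 0 → u 1 ≡ v 1 →
  (∀ n → u (2 + n) ≡ u n + a n * u (n ∸ 4)) → (∀ n → v (2 + n) ≡ v n + a n * v (n ∸ 4)) → ∀ n → u n ≡ v n
recurrence-unique a {u} {v} u0≡v0 u1≡v1 u-rec v-rec = <-rec (λ n → u n ≡ v n) step
  where
  step : ∀ n → (∀ {m} → m < n → u m ≡ v m) → u n ≡ v n
  step zero          _       = u0≡v0
  step (suc zero)    _       = u1≡v1
  step (suc (suc n)) smaller = begin
    u (2 + n)             ≡⟨ u-rec n ⟩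
    u n + a n * u (n ∸ 4) ≡⟨ cong₂ (λ x y → x + a n * y) (smaller (m<n⇒m<1+n (n<1+n n)))
                                                         (smaller (s≤s (m≤n⇒m≤1+n (m∸n≤m n 4)))) ⟩
    v n + a n * v (n ∸ 4) ≡⟨ v-rec n ⟨
    v (2 + n)             ∎
    where open ≡-Reasoning

theorem5p2 : (n : ℕ) → n ≥ 1 → countCubeRootsOfDecreasing n ≡ formula n
theorem5p2 n _ = begin
  countCubeRootsOfDecreasing n ≡⟨ countCubeRootsOfDecreasing≡cubeRootCount n ⟩
  cubeRootCount n              ≡⟨ recurrence-unique (λ n → 4 * ⌊ n /2⌋ * ⌊ n ∸ 2 /2⌋) refl refl
                                    cubeRootCount-rec formulaInPairs-half-rec n ⟩
  formulaInPairs ⌊ n /2⌋       ≡⟨ formula≡formulaInPairs n ⟨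
  formula n                    ∎
  where open ≡-Reasoning
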